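{- For every $\delta>0$ there exists an instance of weighted correlation clustering on a complete graph whose negative weights satisfy the triangle inequality and whose integrality gap is at least $6/5-\delta$, i.e., the minimum cost of a clustering is at least $(6/5-\delta)$ times the optimal value of the LP relaxation.
   Context: Weighted correlation clustering on a complete graph: a finite vertex set $V$ and, for every pair of distinct vertices $u,v$, weights $\lambda^+_{uv},\lambda^-_{uv}\ge 0$ with $\lambda^+_{uv}+\lambda^-_{uv}=1$. A clustering is a partition of $V$; its cost is $\sum_{\{u,v\}}\big(\lambda^+_{uv}\mathbb{1}[u,v \text{ in different parts}]+\lambda^-_{uv}\mathbb{1}[u,v\text{ in the same part}]\big)$. The negative weights satisfy the triangle inequality if $\lambda^-_{uw}\le\lambda^-_{uv}+\lambda^-_{vw}$ for all distinct $u,v,w$. The LP relaxation has real variables $x_{uv}=x_{vu}$: minimize $\sum_{\{u,v\}}\big(\lambda^+_{uv}x_{uv}+\lambda^-_{uv}(1-x_{uv})\big)$ subject to $x_{uv}+x_{vw}\ge x_{uw}$ for all $u,v,w$, $x_{uu}=0$, $0\le x_{uv}\le 1$.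
   Formalization: The parameter δ ranges over the positive rationals, and the weights $\lambda^+_{uv}$ and the LP variables $x_{uv}$ are taken in ℚ rather than in the reals. -}

module Defs where

open import Data.Nat using (ℕ; zero; suc)
open import Data.Fin using (Fin; zero; suc; toℕ; _≟_)
open import Data.Fin.Properties using ()
open import Data.Integer using (+_)
open import Data.Rational using (ℚ; 0ℚ; 1ℚ; _+_; _*_; _-_; _≤_; _<_; _/_)
open import Data.Product using (_×_)
open import Relation.Binary.PropositionalEquality using (_≡_; _≢_)
open import Relation.Nullary using (yes; no)
import Data.Nat as ℕ

sumFin : (n : ℕ) → (Fin n → ℚ) → ℚ
sumFin zero    f = 0ℚ
sumFin (suc n) f = f zero + sumFin n (λ i → f (suc i))

sumPairs : (n : ℕ) → (Fin n → Fin n → ℚ) → ℚ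
sumPairs n f = sumFin n (λ u → sumFin n (λ v → pick u v))
  where
  pick : Fin n → Fin n → ℚ
  pick u v with toℕ u ℕ.<? toℕ v
  ... | yes _ = f u v
  ... | no  _ = 0ℚ

record Instance (n : ℕ) : Set where
  field
    λ⁺      : Fin n → Fin n → ℚ
    λ⁺-sym  : ∀ u v → λ⁺ u v ≡ λ⁺ v u
    λ⁺-nonneg : ∀ u v → 0ℚ ≤ λ⁺ u v
    λ⁺-le1  : ∀ u v → λ⁺ u v ≤ 1ℚ

  λ⁻ : Fin n → Fin n → ℚ
  λ⁻ u v = 1ℚ - λ⁺ u v

open Instance public

NegTriangle : ∀ {n} → Instance n → Set
NegTriangle {n} I = ∀ (u v w : Fin n) → u ≢ v → v ≢ w → u ≢ w →
  λ⁻ I u w ≤ λ⁻ I u v + λ⁻ I v w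

-- A clustering (partition of Fin n) given by a cluster label for every vertex:
-- u and v are in the same part iff they have the same label.
Clustering : ℕ → Set
Clustering n = Fin n → Fin n

clusterCost : ∀ {n} → Instance n → Clustering n → ℚ
clusterCost {n} I c = sumPairs n term
  where
  term : Fin n → Fin n → ℚ
  term u v with c u ≟ c v
  ... | yes _ = λ⁻ I u v
  ... | no  _ = λ⁺ I u v

record LPFeasible (n : ℕ) (x : Fin n → Fin n → ℚ) : Set where
  field
    sym   : ∀ u v → x u v ≡ x v u
    diag  : ∀ u → x u u ≡ 0ℚ
    lower : ∀ u v → 0ℚ ≤ x u v
    upper : ∀ u v → x u v ≤ 1ℚ
    tri   : ∀ u v w → x u w ≤ x u v + x v w

lpCost : ∀ {n} → Instance n → (Fin n → Fin n → ℚ) → ℚ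
lpCost {n} I x = sumPairs n (λ u v → λ⁺ I u v * x u v + λ⁻ I u v * (1ℚ - x u v))

LPOptimal : ∀ {n} → Instance n → (Fin n → Fin n → ℚ) → Set
LPOptimal {n} I x = LPFeasible n x × (∀ y → LPFeasible n y → lpCost I x ≤ lpCost I y)

sixFifths : ℚ
sixFifths = + 6 / 5

module Submission where

-- Take N = 2m vertices split into two sides of m, with side labels σ = ±1.
-- Attraction λ⁺ is 1/3 inside a side and 2/3 across, so every λ⁻ lies in
-- [1/3, 2/3] and the triangle inequality holds.  Every clustering costs at
-- least Λ = Σ_{u<v} λ⁻ = N²/4 - N/3: its excess over Λ is a third of
-- Σ_{u<v} ([u, v in one cluster] - 1) σ_u σ_v, and twice that sum is
-- Σ_k (Σ_{u in cluster k} σ_u)² ≥ 0.  The LP point x (1 inside a side, 1/2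
-- across) costs Λ - (N² - 4N)/24, and it is optimal because the LP objective
-- only depends on W - C, the total of y over ordered pairs inside a side minus
-- the total across: averaging y_uw ≤ y_uv + y_vw over the m vertices v opposite
-- to a pair u ≠ w of one side gives m W ≤ 2(m - 1) C, and with W ≤ 2m(m - 1)
-- this bounds W - C by its value at x.  The ratio Λ / ((5N² - 4N)/24) tends
-- to 6/5.

open import Defs
open import Level using (0ℓ)
open import Algebra.Bundles using (CommutativeRing)
open import Data.Bool using (if_then_else_)
open import Data.Empty using (⊥-elim)
open import Data.Fin using (Fin; zero; suc; toℕ; _≟_; _↑ˡ_; _↑ʳ_; splitAt)
open import Data.Fin.Properties using (<-cmp; <-asym; <-irrefl)
open import Data.Integer using (+[1+_]; +≤+)
import Data.Integer as ℤ
import Data.Integer.Properties as ℤ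
open import Data.Nat using (ℕ; zero; suc; s≤s; z≤n; _<?_)
import Data.Nat as ℕ
open import Data.Nat.Coprimality using (1-coprimeTo) renaming (sym to coprime-sym)
open import Data.Nat.Properties using (*-monoʳ-≤)
open import Data.Product using (Σ; Σ-syntax; ∃-syntax; _×_; _,_; proj₁; proj₂)
open import Data.Rational
  using (ℚ; mkℚ; 0ℚ; 1ℚ; ½; _+_; _*_; _-_; -_; _≤_; _<_; _/_; 1/_; *≤*; Positive; positive; nonNegative; nonPositive)
open import Data.Rational.Literals using (fromℤ)
import Data.Rational.Properties as ℚ
open import Data.Sum using (_⊎_; inj₁; inj₂)
open import Data.Vec.Functional using (replicate; _++_)
open import Data.Vec.Functional.Properties using (lookup-++ˡ; lookup-++ʳ)
open import Function using (_∘_)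
open import Relation.Binary.Definitions using (tri<; tri≈; tri>)
open import Relation.Binary.PropositionalEquality
  using (_≡_; _≢_; refl; sym; trans; cong; cong₂; subst; module ≡-Reasoning)
open import Relation.Nullary using (Dec; does; ¬_)
open import Relation.Nullary.Decidable.Core using (yes; no; dec⇒maybe; toSum)
open import Tactic.RingSolver using (solve-∀)
open import Tactic.RingSolver.Core.AlmostCommutativeRing using (AlmostCommutativeRing; fromCommutativeRing)

open import Algebra.Properties.Ring ℚ.+-*-ring using (-1*x≈-x; [y-z]x≈yx-zx)
open import Algebra.Properties.Semiring.Sum (CommutativeRing.semiring ℚ.+-*-commutativeRing)
  using (sum; sum-syntax; sum-cong-≗; ∑-distrib-+; ∑-comm; *-distribˡ-sum; *-distribʳ-sum; sum-replicate; sum-replicate-zero)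
import Algebra.Properties.Semiring.Mult (CommutativeRing.semiring ℚ.+-*-commutativeRing) as Mult

⅓ ⅔ ⅙ ¼ ¾ : ℚ
⅓ = ℤ.+ 1 / 3
⅔ = ℤ.+ 2 / 3
⅙ = ℤ.+ 1 / 6
¼ = ℤ.+ 1 / 4
¾ = ℤ.+ 3 / 4

ℚ-ring : AlmostCommutativeRing 0ℓ 0ℓ
ℚ-ring = fromCommutativeRing ℚ.+-*-commutativeRing (λ x → dec⇒maybe (0ℚ ℚ.≟ x))

≤-by-gap : ∀ {a b} d → 0ℚ ≤ d → b ≡ a + d → a ≤ b
≤-by-gap {a} {b} d 0≤d b≡a+d = begin
  a       ≡⟨ ℚ.+-identityʳ a ⟨
  a + 0ℚ  ≤⟨ ℚ.+-monoʳ-≤ a 0≤d ⟩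
  a + d   ≡⟨ b≡a+d ⟨
  b       ∎
  where open ℚ.≤-Reasoning

≤⇒0≤- : ∀ {a b} → a ≤ b → 0ℚ ≤ b - a
≤⇒0≤- {a} {b} a≤b = subst (_≤ b - a) (ℚ.+-inverseʳ a) (ℚ.+-monoˡ-≤ (- a) a≤b)

*-nonneg : ∀ {a b} → 0ℚ ≤ a → 0ℚ ≤ b → 0ℚ ≤ a * b
*-nonneg {a} {b} 0≤a 0≤b = ℚ.nonNegative⁻¹ _ {{ℚ.nonNeg*nonNeg⇒nonNeg a {{nonNegative 0≤a}} b {{nonNegative 0≤b}}}}

*-monoˡ-≤-nonneg : ∀ r {a b} → 0ℚ ≤ r → a ≤ b → r * a ≤ r * b
*-monoˡ-≤-nonneg r 0≤r = ℚ.*-monoˡ-≤-nonNeg r {{nonNegative 0≤r}}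

*-cancelˡ-nonneg : ∀ {d g} → 0ℚ < d → 0ℚ ≤ d * g → 0ℚ ≤ g
*-cancelˡ-nonneg {d} {g} 0<d 0≤dg = ℚ.*-cancelˡ-≤-pos d {{positive 0<d}} (subst (_≤ d * g) (sym (ℚ.*-zeroʳ d)) 0≤dg)

square-nonneg : ∀ a → 0ℚ ≤ a * a
square-nonneg a with ℚ.≤-total 0ℚ a
... | inj₁ 0≤a = *-nonneg 0≤a 0≤a
... | inj₂ a≤0 = ℚ.nonNegative⁻¹ _ {{ℚ.nonPos*nonPos⇒nonPos a {{nonPositive a≤0}} a {{nonPositive a≤0}}}}

fromℕ : ℕ → ℚ
fromℕ n = n Mult.× 1ℚ

fromℕ-nonneg : ∀ k → 0ℚ ≤ fromℕ k
fromℕ-nonneg zero    = ℚ.≤-refl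
fromℕ-nonneg (suc k) = ℚ.+-mono-≤ (ℚ.nonNegative⁻¹ 1ℚ) (fromℕ-nonneg k)

fromℕ≡fromℤ : ∀ k → fromℕ k ≡ fromℤ (ℤ.+ k)
fromℕ≡fromℤ zero    = refl
fromℕ≡fromℤ (suc k) = begin
  1ℚ + fromℕ k            ≡⟨ cong (1ℚ +_) (fromℕ≡fromℤ k) ⟩
  1ℚ + fromℤ (ℤ.+ k)      ≡⟨ cong (λ i → (ℤ.+ 1 ℤ.+ i) / 1) (ℤ.*-identityʳ (ℤ.+ k)) ⟩
  ℤ.+ suc k / 1           ≡⟨ ℚ.normalize-coprime (coprime-sym (1-coprimeTo (suc k))) ⟩
  fromℤ (ℤ.+ suc k)       ∎
  where open ≡-Reasoning

archimedean : ∀ δ → Positive δ → ∃[ k ] 1ℚ ≤ δ * fromℕ k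
archimedean δ@(mkℚ +[1+ a ] b _) _ = suc b , (begin
  1ℚ                      ≡⟨ ℚ.*-inverseʳ δ ⟨
  δ * 1/ δ                ≤⟨ *-monoˡ-≤-nonneg δ (ℚ.≤ᵇ⇒≤ _) 1/δ≤suc-b ⟩
  δ * fromℤ (ℤ.+ suc b)   ≡⟨ cong (δ *_) (fromℕ≡fromℤ (suc b)) ⟨
  δ * fromℕ (suc b)       ∎)
  where
  open ℚ.≤-Reasoning
  1/δ≤suc-b : 1/ δ ≤ fromℤ (ℤ.+ suc b)
  1/δ≤suc-b = *≤* (+≤+ (*-monoʳ-≤ (suc b) (s≤s z≤n)))

⟦_⟧ : ∀ {p} {P : Set p} → Dec P → ℚ
⟦ d ⟧ = if does d then 1ℚ else 0ℚ

⟦⟧-yes : ∀ {p} {P : Set p} (d : Dec P) → P → ⟦ d ⟧ ≡ 1ℚ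
⟦⟧-yes (yes _) _ = refl
⟦⟧-yes (no ¬p) p = ⊥-elim (¬p p)

⟦⟧-no : ∀ {p} {P : Set p} (d : Dec P) → ¬ P → ⟦ d ⟧ ≡ 0ℚ
⟦⟧-no (yes p) ¬p = ⊥-elim (¬p p)
⟦⟧-no (no _)  _  = refl

1-⟦⟧-nonneg : ∀ {p} {P : Set p} (d : Dec P) → 0ℚ ≤ 1ℚ - ⟦ d ⟧
1-⟦⟧-nonneg (yes _) = ℚ.≤ᵇ⇒≤ _
1-⟦⟧-nonneg (no _)  = ℚ.≤ᵇ⇒≤ _

⟦≟⟧-sym : ∀ {n} (u v : Fin n) → ⟦ u ≟ v ⟧ ≡ ⟦ v ≟ u ⟧
⟦≟⟧-sym u v with u ≟ v
... | yes refl = sym (⟦⟧-yes (u ≟ u) refl)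
... | no u≢v   = sym (⟦⟧-no (v ≟ u) (u≢v ∘ sym))

sumFin≡sum : ∀ n (f : Fin n → ℚ) → sumFin n f ≡ sum f
sumFin≡sum zero    f = refl
sumFin≡sum (suc n) f = cong (f zero +_) (sumFin≡sum n (f ∘ suc))

sum-const : ∀ n a → ∑[ i < n ] a ≡ fromℕ n * a
sum-const n a = begin
  ∑[ i < n ] a        ≡⟨ sum-replicate n ⟩
  n Mult.× a          ≡⟨ cong (n Mult.×_) (ℚ.*-identityˡ a) ⟨
  n Mult.× (1ℚ * a)   ≡⟨ Mult.×-assoc-* n 1ℚ a ⟨
  fromℕ n * a         ∎
  where open ≡-Reasoning

sum-*ˡ : ∀ {n} a (f : Fin n → ℚ) → ∑[ i < n ] (a * f i) ≡ a * sum f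
sum-*ˡ a f = sym (*-distribˡ-sum a f)

sum-*ʳ : ∀ {n} (f : Fin n → ℚ) a → ∑[ i < n ] (f i * a) ≡ sum f * a
sum-*ʳ f a = sym (*-distribʳ-sum a f)

sum-minus : ∀ {n} (f g : Fin n → ℚ) → ∑[ i < n ] (f i - g i) ≡ sum f - sum g
sum-minus {n} f g = begin
  ∑[ i < n ] (f i - g i)        ≡⟨ ∑-distrib-+ f (λ i → - g i) ⟩
  sum f + ∑[ i < n ] (- g i)    ≡⟨ cong (sum f +_) (sum-cong-≗ (λ i → -1*x≈-x (g i))) ⟨
  sum f + ∑[ i < n ] (- 1ℚ * g i) ≡⟨ cong (sum f +_) (trans (sum-*ˡ (- 1ℚ) g) (-1*x≈-x (sum g))) ⟩
  sum f - sum g                 ∎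
  where open ≡-Reasoning

sum-mono-≤ : ∀ {n} {f g : Fin n → ℚ} → (∀ i → f i ≤ g i) → sum f ≤ sum g
sum-mono-≤ {zero}  _   = ℚ.≤-refl
sum-mono-≤ {suc n} f≤g = ℚ.+-mono-≤ (f≤g zero) (sum-mono-≤ (f≤g ∘ suc))

sum-nonneg : ∀ {n} {f : Fin n → ℚ} → (∀ i → 0ℚ ≤ f i) → 0ℚ ≤ sum f
sum-nonneg {n} {f} 0≤f = subst (_≤ sum f) (sum-replicate-zero n) (sum-mono-≤ 0≤f)

sum-select : ∀ {n} (i : Fin n) (f : Fin n → ℚ) → ∑[ j < n ] (⟦ i ≟ j ⟧ * f j) ≡ f i
sum-select {suc n} zero f = begin
  1ℚ * f zero + ∑[ j < n ] (0ℚ * f (suc j))   ≡⟨ cong₂ _+_ (ℚ.*-identityˡ (f zero)) (sum-cong-≗ (ℚ.*-zeroˡ ∘ f ∘ suc)) ⟩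
  f zero + ∑[ j < n ] 0ℚ                       ≡⟨ cong (f zero +_) (sum-replicate-zero n) ⟩
  f zero + 0ℚ                                  ≡⟨ ℚ.+-identityʳ (f zero) ⟩
  f zero                                       ∎
  where open ≡-Reasoning
sum-select {suc n} (suc i) f = begin
  0ℚ * f zero + ∑[ j < n ] (⟦ i ≟ j ⟧ * f (suc j))   ≡⟨ cong₂ _+_ (ℚ.*-zeroˡ (f zero)) (sum-select i (f ∘ suc)) ⟩
  0ℚ + f (suc i)                                    ≡⟨ ℚ.+-identityˡ (f (suc i)) ⟩
  f (suc i)                                         ∎
  where open ≡-Reasoning

sum-offdiagonal : ∀ {n} (u : Fin n) (f : Fin n → ℚ) → ∑[ v < n ] ((1ℚ - ⟦ u ≟ v ⟧) * f v) ≡ sum f - f u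
sum-offdiagonal {n} u f = begin
  ∑[ v < n ] ((1ℚ - ⟦ u ≟ v ⟧) * f v)        ≡⟨ sum-cong-≗ (λ v → [y-z]x≈yx-zx (f v) 1ℚ ⟦ u ≟ v ⟧) ⟩
  ∑[ v < n ] (1ℚ * f v - ⟦ u ≟ v ⟧ * f v)    ≡⟨ sum-minus (λ v → 1ℚ * f v) (λ v → ⟦ u ≟ v ⟧ * f v) ⟩
  ∑[ v < n ] (1ℚ * f v) - ∑[ v < n ] (⟦ u ≟ v ⟧ * f v)
    ≡⟨ cong₂ _-_ (trans (sum-*ˡ 1ℚ f) (ℚ.*-identityˡ (sum f))) (sum-select u f) ⟩
  sum f - f u                                ∎
  where open ≡-Reasoning

sum-splitAt : ∀ m {n} (f : Fin (m ℕ.+ n) → ℚ) → sum f ≡ ∑[ i < m ] f (i ↑ˡ n) + ∑[ j < n ] f (m ↑ʳ j)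
sum-splitAt zero        f = sym (ℚ.+-identityˡ (sum f))
sum-splitAt (suc m) {n} f = trans (cong (f zero +_) (sum-splitAt m (f ∘ suc)))
  (sym (ℚ.+-assoc (f zero) (∑[ i < m ] f (suc (i ↑ˡ n))) (∑[ j < n ] f (suc m ↑ʳ j))))

sum²-+ : ∀ {n} (f g : Fin n → Fin n → ℚ) →
  ∑[ u < n ] ∑[ v < n ] (f u v + g u v) ≡ ∑[ u < n ] ∑[ v < n ] f u v + ∑[ u < n ] ∑[ v < n ] g u v
sum²-+ {n} f g = trans (sum-cong-≗ (λ u → ∑-distrib-+ (f u) (g u)))
  (∑-distrib-+ (λ u → ∑[ v < n ] f u v) (λ u → ∑[ v < n ] g u v))

sum²-minus : ∀ {n} (f g : Fin n → Fin n → ℚ) →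
  ∑[ u < n ] ∑[ v < n ] (f u v - g u v) ≡ ∑[ u < n ] ∑[ v < n ] f u v - ∑[ u < n ] ∑[ v < n ] g u v
sum²-minus {n} f g = trans (sum-cong-≗ (λ u → sum-minus (f u) (g u)))
  (sum-minus (λ u → ∑[ v < n ] f u v) (λ u → ∑[ v < n ] g u v))

sum²-*ˡ : ∀ {n} a (f : Fin n → Fin n → ℚ) → ∑[ u < n ] ∑[ v < n ] (a * f u v) ≡ a * ∑[ u < n ] ∑[ v < n ] f u v
sum²-*ˡ {n} a f = trans (sum-cong-≗ (λ u → sum-*ˡ a (f u))) (sum-*ˡ a (λ u → ∑[ v < n ] f u v))

sum²-product : ∀ {n} (f g : Fin n → ℚ) → ∑[ u < n ] ∑[ v < n ] (f u * g v) ≡ sum f * sum g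
sum²-product f g = trans (sum-cong-≗ (λ u → sum-*ˡ (f u) g)) (sum-*ʳ f (sum g))

sum²-diagonal : ∀ {n} (f : Fin n → Fin n → ℚ) → ∑[ u < n ] ∑[ v < n ] (⟦ u ≟ v ⟧ * f u v) ≡ ∑[ u < n ] f u u
sum²-diagonal f = sum-cong-≗ (λ u → sum-select u (f u))

sum²-offdiagonal : ∀ {n} (f : Fin n → Fin n → ℚ) →
  ∑[ u < n ] ∑[ v < n ] ((1ℚ - ⟦ u ≟ v ⟧) * f u v) ≡ ∑[ u < n ] ∑[ v < n ] f u v - ∑[ u < n ] f u u
sum²-offdiagonal {n} f = trans (sum-cong-≗ (λ u → sum-offdiagonal u (f u)))
  (sum-minus (λ u → ∑[ v < n ] f u v) (λ u → f u u))

sum²-gram-nonneg : ∀ {m n} (A : Fin m → Fin n → ℚ) → 0ℚ ≤ ∑[ u < n ] ∑[ v < n ] ∑[ k < m ] (A k u * A k v)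
sum²-gram-nonneg {m} {n} A = subst (0ℚ ≤_) (sym gram) (sum-nonneg (λ k → square-nonneg (sum (A k))))
  where
  open ≡-Reasoning
  gram : ∑[ u < n ] ∑[ v < n ] ∑[ k < m ] (A k u * A k v) ≡ ∑[ k < m ] (sum (A k) * sum (A k))
  gram = begin
    ∑[ u < n ] ∑[ v < n ] ∑[ k < m ] (A k u * A k v)   ≡⟨ sum-cong-≗ (λ u → ∑-comm (λ v k → A k u * A k v)) ⟩
    ∑[ u < n ] ∑[ k < m ] ∑[ v < n ] (A k u * A k v)   ≡⟨ ∑-comm (λ u k → ∑[ v < n ] (A k u * A k v)) ⟩
    ∑[ k < m ] ∑[ u < n ] ∑[ v < n ] (A k u * A k v)   ≡⟨ sum-cong-≗ (λ k → sum²-product (A k) (A k)) ⟩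
    ∑[ k < m ] (sum (A k) * sum (A k))                 ∎

⟦_≺_⟧ : ∀ {n} → Fin n → Fin n → ℚ
⟦ u ≺ v ⟧ = ⟦ toℕ u <? toℕ v ⟧

⟦≺⟧-trichotomy : ∀ {n} (u v : Fin n) → ⟦ u ≺ v ⟧ + ⟦ v ≺ u ⟧ + ⟦ u ≟ v ⟧ ≡ 1ℚ
⟦≺⟧-trichotomy u v with <-cmp u v
... | tri< u<v u≢v _ = cong₂ _+_
  (cong₂ _+_ (⟦⟧-yes (toℕ u <? toℕ v) u<v) (⟦⟧-no (toℕ v <? toℕ u) (<-asym u<v))) (⟦⟧-no (u ≟ v) u≢v)
... | tri≈ _ refl _ = cong₂ _+_
  (cong₂ _+_ (⟦⟧-no (toℕ u <? toℕ u) (<-irrefl refl)) (⟦⟧-no (toℕ u <? toℕ u) (<-irrefl refl))) (⟦⟧-yes (u ≟ u) refl)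
... | tri> _ u≢v v<u = cong₂ _+_
  (cong₂ _+_ (⟦⟧-no (toℕ u <? toℕ v) (<-asym v<u)) (⟦⟧-yes (toℕ v <? toℕ u) v<u)) (⟦⟧-no (u ≟ v) u≢v)

-- The summands of sumPairs and clusterCost are anonymous with-functions of
-- Defs; unification names them (summand = _ , refl), after which `with` on the
-- decision they are stuck on evaluates them.
sumPairs≡sum² : ∀ n f → sumPairs n f ≡ ∑[ u < n ] ∑[ v < n ] (⟦ u ≺ v ⟧ * f u v)
sumPairs≡sum² n f = trans (sumFin≡sum n (λ u → sumFin n (term u)))
  (sum-cong-≗ (λ u → trans (sumFin≡sum n (term u)) (sum-cong-≗ (term-spec u))))
  where
  summand : Σ[ t ∈ (Fin n → Fin n → ℚ) ] sumPairs n f ≡ sumFin n (λ u → sumFin n (t u))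
  summand = _ , refl

  term : Fin n → Fin n → ℚ
  term = proj₁ summand

  term-spec : ∀ u v → term u v ≡ ⟦ u ≺ v ⟧ * f u v
  term-spec u v with toℕ u <? toℕ v
  ... | yes u<v = sym (trans (cong (_* f u v) (⟦⟧-yes (toℕ u <? toℕ v) u<v)) (ℚ.*-identityˡ (f u v)))
  ... | no u≮v  = sym (trans (cong (_* f u v) (⟦⟧-no (toℕ u <? toℕ v) u≮v)) (ℚ.*-zeroˡ (f u v)))

sumPairs-cong : ∀ n {f g : Fin n → Fin n → ℚ} → (∀ u v → f u v ≡ g u v) → sumPairs n f ≡ sumPairs n g
sumPairs-cong n {f} {g} f≡g = begin
  sumPairs n f                                ≡⟨ sumPairs≡sum² n f ⟩
  ∑[ u < n ] ∑[ v < n ] (⟦ u ≺ v ⟧ * f u v)   ≡⟨ sum-cong-≗ (λ u → sum-cong-≗ (λ v → cong (⟦ u ≺ v ⟧ *_) (f≡g u v))) ⟩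
  ∑[ u < n ] ∑[ v < n ] (⟦ u ≺ v ⟧ * g u v)   ≡⟨ sumPairs≡sum² n g ⟨
  sumPairs n g                                ∎
  where open ≡-Reasoning

sumPairs-lincomb : ∀ n {f g h : Fin n → Fin n → ℚ} a → (∀ u v → f u v ≡ g u v + a * h u v) →
  sumPairs n f ≡ sumPairs n g + a * sumPairs n h
sumPairs-lincomb n {f} {g} {h} a f≡g+ah = begin
  sumPairs n f
    ≡⟨ sumPairs≡sum² n f ⟩
  ∑[ u < n ] ∑[ v < n ] (⟦ u ≺ v ⟧ * f u v)
    ≡⟨ sum-cong-≗ (λ u → sum-cong-≗ (λ v → trans (cong (⟦ u ≺ v ⟧ *_) (f≡g+ah u v)) (distribute a ⟦ u ≺ v ⟧ (g u v) (h u v)))) ⟩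
  ∑[ u < n ] ∑[ v < n ] (⟦ u ≺ v ⟧ * g u v + a * (⟦ u ≺ v ⟧ * h u v))
    ≡⟨ sum²-+ (λ u v → ⟦ u ≺ v ⟧ * g u v) (λ u v → a * (⟦ u ≺ v ⟧ * h u v)) ⟩
  ∑[ u < n ] ∑[ v < n ] (⟦ u ≺ v ⟧ * g u v) + ∑[ u < n ] ∑[ v < n ] (a * (⟦ u ≺ v ⟧ * h u v))
    ≡⟨ cong (∑[ u < n ] ∑[ v < n ] (⟦ u ≺ v ⟧ * g u v) +_) (sum²-*ˡ a (λ u v → ⟦ u ≺ v ⟧ * h u v)) ⟩
  ∑[ u < n ] ∑[ v < n ] (⟦ u ≺ v ⟧ * g u v) + a * ∑[ u < n ] ∑[ v < n ] (⟦ u ≺ v ⟧ * h u v)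
    ≡⟨ cong₂ (λ s t → s + a * t) (sumPairs≡sum² n g) (sumPairs≡sum² n h) ⟨
  sumPairs n g + a * sumPairs n h
    ∎
  where
  open ≡-Reasoning
  distribute : ∀ a e s t → e * (s + a * t) ≡ e * s + a * (e * t)
  distribute = solve-∀ ℚ-ring

sumPairs-symmetric : ∀ n {g : Fin n → Fin n → ℚ} → (∀ u v → g u v ≡ g v u) →
  sumPairs n g ≡ ½ * (∑[ u < n ] ∑[ v < n ] g u v - ∑[ u < n ] g u u)
sumPairs-symmetric n {g} g-sym = begin
  P                                       ≡⟨ halve P D ⟩
  ½ * (P + P + D - D)                     ≡⟨ cong (λ s → ½ * (s - D)) decomposition ⟨
  ½ * (∑[ u < n ] ∑[ v < n ] g u v - D)   ∎
  where
  open ≡-Reasoning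
  P D : ℚ
  P = sumPairs n g
  D = ∑[ u < n ] g u u

  halve : ∀ P D → P ≡ ½ * (P + P + D - D)
  halve = solve-∀ ℚ-ring

  distribute : ∀ a b c t → (a + b + c) * t ≡ a * t + b * t + c * t
  distribute = solve-∀ ℚ-ring

  split : ∀ u v → g u v ≡ ⟦ u ≺ v ⟧ * g u v + ⟦ v ≺ u ⟧ * g v u + ⟦ u ≟ v ⟧ * g u v
  split u v = begin
    g u v
      ≡⟨ ℚ.*-identityˡ (g u v) ⟨
    1ℚ * g u v
      ≡⟨ cong (_* g u v) (⟦≺⟧-trichotomy u v) ⟨
    (⟦ u ≺ v ⟧ + ⟦ v ≺ u ⟧ + ⟦ u ≟ v ⟧) * g u v
      ≡⟨ distribute ⟦ u ≺ v ⟧ ⟦ v ≺ u ⟧ ⟦ u ≟ v ⟧ (g u v) ⟩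
    ⟦ u ≺ v ⟧ * g u v + ⟦ v ≺ u ⟧ * g u v + ⟦ u ≟ v ⟧ * g u v
      ≡⟨ cong (λ t → ⟦ u ≺ v ⟧ * g u v + ⟦ v ≺ u ⟧ * t + ⟦ u ≟ v ⟧ * g u v) (g-sym u v) ⟩
    ⟦ u ≺ v ⟧ * g u v + ⟦ v ≺ u ⟧ * g v u + ⟦ u ≟ v ⟧ * g u v
      ∎

  decomposition : ∑[ u < n ] ∑[ v < n ] g u v ≡ P + P + D
  decomposition = begin
    ∑[ u < n ] ∑[ v < n ] g u v
      ≡⟨ sum-cong-≗ (λ u → sum-cong-≗ (split u)) ⟩
    ∑[ u < n ] ∑[ v < n ] (⟦ u ≺ v ⟧ * g u v + ⟦ v ≺ u ⟧ * g v u + ⟦ u ≟ v ⟧ * g u v)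
      ≡⟨ sum²-+ (λ u v → ⟦ u ≺ v ⟧ * g u v + ⟦ v ≺ u ⟧ * g v u) (λ u v → ⟦ u ≟ v ⟧ * g u v) ⟩
    ∑[ u < n ] ∑[ v < n ] (⟦ u ≺ v ⟧ * g u v + ⟦ v ≺ u ⟧ * g v u) + ∑[ u < n ] ∑[ v < n ] (⟦ u ≟ v ⟧ * g u v)
      ≡⟨ cong₂ _+_ (sum²-+ (λ u v → ⟦ u ≺ v ⟧ * g u v) (λ u v → ⟦ v ≺ u ⟧ * g v u)) (sum²-diagonal g) ⟩
    ∑[ u < n ] ∑[ v < n ] (⟦ u ≺ v ⟧ * g u v) + ∑[ u < n ] ∑[ v < n ] (⟦ v ≺ u ⟧ * g v u) + D
      ≡⟨ cong (λ t → ∑[ u < n ] ∑[ v < n ] (⟦ u ≺ v ⟧ * g u v) + t + D) (∑-comm (λ u v → ⟦ u ≺ v ⟧ * g u v)) ⟨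
    ∑[ u < n ] ∑[ v < n ] (⟦ u ≺ v ⟧ * g u v) + ∑[ u < n ] ∑[ v < n ] (⟦ u ≺ v ⟧ * g u v) + D
      ≡⟨ cong (λ t → t + t + D) (sumPairs≡sum² n g) ⟨
    P + P + D
      ∎

sumPairs-hollow : ∀ n {g : Fin n → Fin n → ℚ} → (∀ u v → g u v ≡ g v u) → (∀ u → g u u ≡ 0ℚ) →
  sumPairs n g ≡ ½ * ∑[ u < n ] ∑[ v < n ] g u v
sumPairs-hollow n {g} g-sym g-diag = begin
  sumPairs n g                                                  ≡⟨ sumPairs-symmetric n g-sym ⟩
  ½ * (∑[ u < n ] ∑[ v < n ] g u v - ∑[ u < n ] g u u)          ≡⟨ cong (λ t → ½ * (∑[ u < n ] ∑[ v < n ] g u v - t)) diagonal ⟩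
  ½ * (∑[ u < n ] ∑[ v < n ] g u v - 0ℚ)                        ≡⟨ cong (½ *_) (ℚ.+-identityʳ (∑[ u < n ] ∑[ v < n ] g u v)) ⟩
  ½ * ∑[ u < n ] ∑[ v < n ] g u v                               ∎
  where
  open ≡-Reasoning
  diagonal : ∑[ u < n ] g u u ≡ 0ℚ
  diagonal = trans (sum-cong-≗ g-diag) (sum-replicate-zero n)

clusterCost≡sumPairs : ∀ {n} (I : Instance n) (c : Clustering n) →
  clusterCost I c ≡ sumPairs n (λ u v → λ⁺ I u v + ⟦ c u ≟ c v ⟧ * (λ⁻ I u v - λ⁺ I u v))
clusterCost≡sumPairs {n} I c = sumPairs-cong n term-spec
  where
  summand : Σ[ t ∈ (Fin n → Fin n → ℚ) ] clusterCost I c ≡ sumPairs n t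
  summand = _ , refl

  term : Fin n → Fin n → ℚ
  term = proj₁ summand

  together : ∀ a b → a ≡ b + 1ℚ * (a - b)
  together = solve-∀ ℚ-ring

  term-spec : ∀ u v → term u v ≡ λ⁺ I u v + ⟦ c u ≟ c v ⟧ * (λ⁻ I u v - λ⁺ I u v)
  term-spec u v with c u ≟ c v
  ... | yes _ = together (λ⁻ I u v) (λ⁺ I u v)
  ... | no _  = sym (trans (cong (λ⁺ I u v +_) (ℚ.*-zeroˡ (λ⁻ I u v - λ⁺ I u v))) (ℚ.+-identityʳ (λ⁺ I u v)))

dual-arithmetic : ∀ {N W C} → fromℕ 4 ≤ N → ½ * N * W ≤ (½ * N - 1ℚ) * (C + C) → W ≤ ½ * N * N - N →
  W - C ≤ ¼ * (N * N) - N
dual-arithmetic {N} {W} {C} 4≤N averaged W-bound = ≤-by-gap g (*-cancelˡ-nonneg 0<d 0≤dg) (complete N W C)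
  where
  d g : ℚ
  d = ½ * N - 1ℚ
  g = ¼ * (N * N) - N - (W - C)
  complete : ∀ N W C → ¼ * (N * N) - N ≡ W - C + (¼ * (N * N) - N - (W - C))
  complete = solve-∀ ℚ-ring
  -- d · g is a nonnegative combination of the slacks of the two hypotheses.
  scaled : ∀ N W C → (½ * N - 1ℚ) * (¼ * (N * N) - N - (W - C))
                     ≡ ½ * ((½ * N - 1ℚ) * (C + C) - ½ * N * W) + ½ * (½ * (N - fromℕ 4) * (½ * N * N - N - W))
  scaled = solve-∀ ℚ-ring
  shift : ∀ N → ½ * N - 1ℚ ≡ 1ℚ + ½ * (N - fromℕ 4)
  shift = solve-∀ ℚ-ring
  0≤N-4 : 0ℚ ≤ N - fromℕ 4
  0≤N-4 = ≤⇒0≤- 4≤N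
  0<d : 0ℚ < d
  0<d = ℚ.<-≤-trans (ℚ.positive⁻¹ 1ℚ) (≤-by-gap (½ * (N - fromℕ 4)) (*-nonneg {½} (ℚ.≤ᵇ⇒≤ _) 0≤N-4) (shift N))
  0≤dg : 0ℚ ≤ d * g
  0≤dg = subst (0ℚ ≤_) (sym (scaled N W C))
    (ℚ.+-mono-≤ (*-nonneg {½} (ℚ.≤ᵇ⇒≤ _) (≤⇒0≤- averaged))
                (*-nonneg {½} (ℚ.≤ᵇ⇒≤ _) (*-nonneg (*-nonneg {½} (ℚ.≤ᵇ⇒≤ _) 0≤N-4) (≤⇒0≤- W-bound))))

lp-value-positive : ∀ {N} → fromℕ 4 ≤ N → 0ℚ < ¼ * (N * N) - ⅓ * N - ⅙ * (¼ * (N * N) - N)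
lp-value-positive {N} 4≤N = ℚ.<-≤-trans (ℚ.positive⁻¹ (ℤ.+ 8 / 3)) (≤-by-gap _ 0≤excess (expand N))
  where
  expand : ∀ N → ¼ * (N * N) - ⅓ * N - ⅙ * (¼ * (N * N) - N)
                 ≡ ℤ.+ 8 / 3 + ℤ.+ 1 / 24 * ((N - fromℕ 4) * (ℤ.+ 5 / 1 * (N - fromℕ 4) + ℤ.+ 36 / 1))
  expand = solve-∀ ℚ-ring
  0≤N-4 : 0ℚ ≤ N - fromℕ 4
  0≤N-4 = ≤⇒0≤- 4≤N
  0≤excess : 0ℚ ≤ ℤ.+ 1 / 24 * ((N - fromℕ 4) * (ℤ.+ 5 / 1 * (N - fromℕ 4) + ℤ.+ 36 / 1))
  0≤excess = *-nonneg {ℤ.+ 1 / 24} (ℚ.≤ᵇ⇒≤ _)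
    (*-nonneg 0≤N-4 (ℚ.+-mono-≤ (*-nonneg {ℤ.+ 5 / 1} (ℚ.≤ᵇ⇒≤ _) 0≤N-4) (ℚ.nonNegative⁻¹ (ℤ.+ 36 / 1))))

gap-arithmetic : ∀ {N δ} → fromℕ 4 ≤ N → 0ℚ ≤ δ → 1ℚ ≤ δ * N →
  (sixFifths - δ) * (¼ * (N * N) - ⅓ * N - ⅙ * (¼ * (N * N) - N)) ≤ ¼ * (N * N) - ⅓ * N
gap-arithmetic {N} {δ} 4≤N 0≤δ 1≤δN = ≤-by-gap _ 0≤excess (expand N δ)
  where
  expand : ∀ N δ → ¼ * (N * N) - ⅓ * N
                   ≡ (sixFifths - δ) * (¼ * (N * N) - ⅓ * N - ⅙ * (¼ * (N * N) - N))
                     + ℤ.+ 1 / 24 * N * (fromℕ 4 * (δ * N - 1ℚ) + δ * (N - fromℕ 4) + ℤ.+ 4 / 5)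
  expand = solve-∀ ℚ-ring
  0≤excess : 0ℚ ≤ ℤ.+ 1 / 24 * N * (fromℕ 4 * (δ * N - 1ℚ) + δ * (N - fromℕ 4) + ℤ.+ 4 / 5)
  0≤excess = *-nonneg (*-nonneg {ℤ.+ 1 / 24} (ℚ.≤ᵇ⇒≤ _) (ℚ.≤-trans (ℚ.≤ᵇ⇒≤ _) 4≤N))
    (ℚ.+-mono-≤ (ℚ.+-mono-≤ (*-nonneg {fromℕ 4} (ℚ.≤ᵇ⇒≤ _) (≤⇒0≤- 1≤δN)) (*-nonneg 0≤δ (≤⇒0≤- 4≤N)))
                (ℚ.nonNegative⁻¹ (ℤ.+ 4 / 5)))

-- The instance on two balanced sides

-- σ labels the two sides, so p u v is 1 for u, v on the same side and -1 across.
module BalancedInstance {n : ℕ} (σ : Fin n → ℚ)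
  (σ-sign : ∀ u → σ u ≡ 1ℚ ⊎ σ u ≡ - 1ℚ) (σ-balanced : sum σ ≡ 0ℚ) where

  N : ℚ
  N = fromℕ n

  p : Fin n → Fin n → ℚ
  p u v = σ u * σ v

  p-sym : ∀ u v → p u v ≡ p v u
  p-sym u v = ℚ.*-comm (σ u) (σ v)

  p-diag : ∀ u → p u u ≡ 1ℚ
  p-diag u with σ-sign u
  ... | inj₁ σu≡1  rewrite σu≡1  = refl
  ... | inj₂ σu≡-1 rewrite σu≡-1 = refl

  p-cases : (P : ℚ → Set) → P 1ℚ → P (- 1ℚ) → ∀ u v → P (p u v)
  p-cases P P1 P-1 u v with σ-sign u | σ-sign v
  ... | inj₁ σu≡1  | inj₁ σv≡1  rewrite σu≡1  | σv≡1  = P1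
  ... | inj₁ σu≡1  | inj₂ σv≡-1 rewrite σu≡1  | σv≡-1 = P-1
  ... | inj₂ σu≡-1 | inj₁ σv≡1  rewrite σu≡-1 | σv≡1  = P-1
  ... | inj₂ σu≡-1 | inj₂ σv≡-1 rewrite σu≡-1 | σv≡-1 = P1

  p-row : ∀ u → ∑[ v < n ] p u v ≡ 0ℚ
  p-row u = trans (sum-*ˡ (σ u) σ) (trans (cong (σ u *_) σ-balanced) (ℚ.*-zeroʳ (σ u)))

  sum²-p : ∑[ u < n ] ∑[ v < n ] p u v ≡ 0ℚ
  sum²-p = trans (sum²-product σ σ) (trans (cong (_* sum σ) σ-balanced) (ℚ.*-zeroˡ (sum σ)))

  sum-affine-p : ∀ α β u → ∑[ v < n ] (α + β * p u v) ≡ N * α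
  sum-affine-p α β u = begin
    ∑[ v < n ] (α + β * p u v)              ≡⟨ ∑-distrib-+ (λ _ → α) (λ v → β * p u v) ⟩
    ∑[ v < n ] α + ∑[ v < n ] (β * p u v)   ≡⟨ cong₂ _+_ (sum-const n α) (trans (sum-*ˡ β (p u)) (cong (β *_) (p-row u))) ⟩
    N * α + β * 0ℚ                          ≡⟨ cong (N * α +_) (ℚ.*-zeroʳ β) ⟩
    N * α + 0ℚ                              ≡⟨ ℚ.+-identityʳ (N * α) ⟩
    N * α                                   ∎
    where open ≡-Reasoning

  sum²-affine-p : ∀ α β → ∑[ u < n ] ∑[ v < n ] (α + β * p u v) ≡ N * (N * α)
  sum²-affine-p α β = trans (sum-cong-≗ (sum-affine-p α β)) (sum-const n (N * α))

  I : Instance n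
  I = record
    { λ⁺        = λ u v → ½ - ⅙ * p u v
    ; λ⁺-sym    = λ u v → cong (λ q → ½ - ⅙ * q) (p-sym u v)
    ; λ⁺-nonneg = p-cases (λ q → 0ℚ ≤ ½ - ⅙ * q) (ℚ.≤ᵇ⇒≤ _) (ℚ.≤ᵇ⇒≤ _)
    ; λ⁺-le1    = p-cases (λ q → ½ - ⅙ * q ≤ 1ℚ) (ℚ.≤ᵇ⇒≤ _) (ℚ.≤ᵇ⇒≤ _)
    }

  negTriangle : NegTriangle I
  negTriangle u v w _ _ _ = begin
    λ⁻ I u w              ≤⟨ p-cases (λ q → 1ℚ - (½ - ⅙ * q) ≤ ⅔) (ℚ.≤ᵇ⇒≤ _) (ℚ.≤ᵇ⇒≤ _) u w ⟩
    ⅓ + ⅓                 ≤⟨ ℚ.+-mono-≤ (⅓≤λ⁻ u v) (⅓≤λ⁻ v w) ⟩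
    λ⁻ I u v + λ⁻ I v w   ∎
    where
    open ℚ.≤-Reasoning
    ⅓≤λ⁻ : ∀ u v → ⅓ ≤ λ⁻ I u v
    ⅓≤λ⁻ = p-cases (λ q → ⅓ ≤ 1ℚ - (½ - ⅙ * q)) (ℚ.≤ᵇ⇒≤ _) (ℚ.≤ᵇ⇒≤ _)

  Λ : ℚ
  Λ = sumPairs n (λ⁻ I)

  Λ-value : Λ ≡ ¼ * (N * N) - ⅓ * N
  Λ-value = begin
    Λ                                                             ≡⟨ sumPairs-symmetric n λ⁻-sym ⟩
    ½ * (∑[ u < n ] ∑[ v < n ] λ⁻ I u v - ∑[ u < n ] λ⁻ I u u)   ≡⟨ cong₂ (λ s t → ½ * (s - t)) all-pairs diagonal ⟩
    ½ * (N * (N * ½) - N * ⅔)                                     ≡⟨ simplify N ⟩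
    ¼ * (N * N) - ⅓ * N                                           ∎
    where
    open ≡-Reasoning
    λ⁻-sym : ∀ u v → λ⁻ I u v ≡ λ⁻ I v u
    λ⁻-sym u v = cong (λ q → 1ℚ - (½ - ⅙ * q)) (p-sym u v)
    affine : ∀ q → 1ℚ - (½ - ⅙ * q) ≡ ½ + ⅙ * q
    affine = solve-∀ ℚ-ring
    simplify : ∀ N → ½ * (N * (N * ½) - N * ⅔) ≡ ¼ * (N * N) - ⅓ * N
    simplify = solve-∀ ℚ-ring
    all-pairs : ∑[ u < n ] ∑[ v < n ] λ⁻ I u v ≡ N * (N * ½)
    all-pairs = trans (sum-cong-≗ (λ u → sum-cong-≗ (λ v → affine (p u v)))) (sum²-affine-p ½ ⅙)
    diagonal : ∑[ u < n ] λ⁻ I u u ≡ N * ⅔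
    diagonal = trans (sum-cong-≗ (λ u → cong (λ q → 1ℚ - (½ - ⅙ * q)) (p-diag u))) (sum-const n ⅔)

  lpCost-affine : ∀ {y} → LPFeasible n y → lpCost I y ≡ Λ - ⅙ * ∑[ u < n ] ∑[ v < n ] (p u v * y u v)
  lpCost-affine {y} y-feasible = begin
    lpCost I y                                        ≡⟨ sumPairs-lincomb n (- ⅓) (λ u v → cost-affine (p u v) (y u v)) ⟩
    Λ + - ⅓ * sumPairs n (λ u v → p u v * y u v)      ≡⟨ cong (λ t → Λ + - ⅓ * t) (sumPairs-hollow n py-sym py-diag) ⟩
    Λ + - ⅓ * (½ * ∑[ u < n ] ∑[ v < n ] (p u v * y u v))
      ≡⟨ simplify Λ (∑[ u < n ] ∑[ v < n ] (p u v * y u v)) ⟩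
    Λ - ⅙ * ∑[ u < n ] ∑[ v < n ] (p u v * y u v)     ∎
    where
    open ≡-Reasoning
    open LPFeasible y-feasible renaming (sym to y-sym; diag to y-diag)
    cost-affine : ∀ q t → (½ - ⅙ * q) * t + (1ℚ - (½ - ⅙ * q)) * (1ℚ - t) ≡ (1ℚ - (½ - ⅙ * q)) + - ⅓ * (q * t)
    cost-affine = solve-∀ ℚ-ring
    simplify : ∀ L S → L + - ⅓ * (½ * S) ≡ L - ⅙ * S
    simplify = solve-∀ ℚ-ring
    py-sym : ∀ u v → p u v * y u v ≡ p v u * y v u
    py-sym u v = cong₂ _*_ (p-sym u v) (y-sym u v)
    py-diag : ∀ u → p u u * y u u ≡ 0ℚ
    py-diag u = trans (cong (p u u *_) (y-diag u)) (ℚ.*-zeroʳ (p u u))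

  sum²-same-cluster-nonneg : (c : Clustering n) → 0ℚ ≤ ∑[ u < n ] ∑[ v < n ] (⟦ c u ≟ c v ⟧ * p u v)
  sum²-same-cluster-nonneg c = subst (0ℚ ≤_) (sum-cong-≗ (λ u → sum-cong-≗ (gram-entry u))) (sum²-gram-nonneg A)
    where
    open ≡-Reasoning
    A : Fin n → Fin n → ℚ
    A k u = ⟦ c u ≟ k ⟧ * σ u
    rearrange : ∀ e f s t → (e * s) * (f * t) ≡ e * (f * (s * t))
    rearrange = solve-∀ ℚ-ring
    gram-entry : ∀ u v → ∑[ k < n ] (A k u * A k v) ≡ ⟦ c u ≟ c v ⟧ * p u v
    gram-entry u v = begin
      ∑[ k < n ] (A k u * A k v)                         ≡⟨ sum-cong-≗ (λ k → rearrange ⟦ c u ≟ k ⟧ ⟦ c v ≟ k ⟧ (σ u) (σ v)) ⟩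
      ∑[ k < n ] (⟦ c u ≟ k ⟧ * (⟦ c v ≟ k ⟧ * p u v))   ≡⟨ sum-select (c u) (λ k → ⟦ c v ≟ k ⟧ * p u v) ⟩
      ⟦ c v ≟ c u ⟧ * p u v                              ≡⟨ cong (_* p u v) (⟦≟⟧-sym (c v) (c u)) ⟩
      ⟦ c u ≟ c v ⟧ * p u v                              ∎

  clusterCost≥Λ : ∀ c → Λ ≤ clusterCost I c
  clusterCost≥Λ c = ≤-by-gap (⅓ * G) (*-nonneg {⅓} (ℚ.≤ᵇ⇒≤ _) G-nonneg) cost≡
    where
    open ≡-Reasoning
    g : Fin n → Fin n → ℚ
    g u v = (⟦ c u ≟ c v ⟧ - 1ℚ) * p u v
    G : ℚ
    G = sumPairs n g
    split-weights : ∀ q e → (½ - ⅙ * q) + e * ((1ℚ - (½ - ⅙ * q)) - (½ - ⅙ * q)) ≡ (1ℚ - (½ - ⅙ * q)) + ⅓ * ((e - 1ℚ) * q)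
    split-weights = solve-∀ ℚ-ring
    cost≡ : clusterCost I c ≡ Λ + ⅓ * G
    cost≡ = trans (clusterCost≡sumPairs I c) (sumPairs-lincomb n ⅓ (λ u v → split-weights (p u v) ⟦ c u ≟ c v ⟧))
    g-sym : ∀ u v → g u v ≡ g v u
    g-sym u v = cong₂ (λ e q → (e - 1ℚ) * q) (⟦≟⟧-sym (c u) (c v)) (p-sym u v)
    g-diag : ∀ u → g u u ≡ 0ℚ
    g-diag u = trans (cong (λ e → (e - 1ℚ) * p u u) (⟦⟧-yes (c u ≟ c u) refl)) (ℚ.*-zeroˡ (p u u))
    sum²-g : ∑[ u < n ] ∑[ v < n ] g u v ≡ ∑[ u < n ] ∑[ v < n ] (⟦ c u ≟ c v ⟧ * p u v)
    sum²-g = begin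
      ∑[ u < n ] ∑[ v < n ] g u v
        ≡⟨ sum-cong-≗ (λ u → sum-cong-≗ (λ v → [y-z]x≈yx-zx (p u v) ⟦ c u ≟ c v ⟧ 1ℚ)) ⟩
      ∑[ u < n ] ∑[ v < n ] (⟦ c u ≟ c v ⟧ * p u v - 1ℚ * p u v)
        ≡⟨ sum²-minus (λ u v → ⟦ c u ≟ c v ⟧ * p u v) (λ u v → 1ℚ * p u v) ⟩
      ∑[ u < n ] ∑[ v < n ] (⟦ c u ≟ c v ⟧ * p u v) - ∑[ u < n ] ∑[ v < n ] (1ℚ * p u v)
        ≡⟨ cong (λ t → ∑[ u < n ] ∑[ v < n ] (⟦ c u ≟ c v ⟧ * p u v) - t) (trans (sum²-*ˡ 1ℚ p) (cong (1ℚ *_) sum²-p)) ⟩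
      ∑[ u < n ] ∑[ v < n ] (⟦ c u ≟ c v ⟧ * p u v) - 0ℚ
        ≡⟨ ℚ.+-identityʳ (∑[ u < n ] ∑[ v < n ] (⟦ c u ≟ c v ⟧ * p u v)) ⟩
      ∑[ u < n ] ∑[ v < n ] (⟦ c u ≟ c v ⟧ * p u v)
        ∎
    G-nonneg : 0ℚ ≤ G
    G-nonneg = subst (0ℚ ≤_) (sym (trans (sumPairs-hollow n g-sym g-diag) (cong (½ *_) sum²-g)))
                 (*-nonneg {½} (ℚ.≤ᵇ⇒≤ _) (sum²-same-cluster-nonneg c))

  x : Fin n → Fin n → ℚ
  x u v = (1ℚ - ⟦ u ≟ v ⟧) * (¾ + ¼ * p u v)

  x-diag : ∀ u → x u u ≡ 0ℚ
  x-diag u = trans (cong (λ e → (1ℚ - e) * (¾ + ¼ * p u u)) (⟦⟧-yes (u ≟ u) refl)) (ℚ.*-zeroˡ (¾ + ¼ * p u u))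

  x-offdiag-bounds : ∀ {u v} → u ≢ v → ½ ≤ x u v × x u v ≤ 1ℚ
  x-offdiag-bounds {u} {v} u≢v = subst (λ t → ½ ≤ t × t ≤ 1ℚ) (sym x≡)
    (p-cases (λ q → ½ ≤ ¾ + ¼ * q × ¾ + ¼ * q ≤ 1ℚ) (ℚ.≤ᵇ⇒≤ _ , ℚ.≤ᵇ⇒≤ _) (ℚ.≤ᵇ⇒≤ _ , ℚ.≤ᵇ⇒≤ _) u v)
    where
    x≡ : x u v ≡ ¾ + ¼ * p u v
    x≡ = trans (cong (λ e → (1ℚ - e) * (¾ + ¼ * p u v)) (⟦⟧-no (u ≟ v) u≢v)) (ℚ.*-identityˡ (¾ + ¼ * p u v))

  x-bounds : ∀ u v → 0ℚ ≤ x u v × x u v ≤ 1ℚ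
  x-bounds u v with toSum (u ≟ v)
  ... | inj₁ refl = subst (λ t → 0ℚ ≤ t × t ≤ 1ℚ) (sym (x-diag u)) (ℚ.≤-refl , ℚ.≤ᵇ⇒≤ _)
  ... | inj₂ u≢v  = ℚ.≤-trans (ℚ.≤ᵇ⇒≤ _) (proj₁ (x-offdiag-bounds u≢v)) , proj₂ (x-offdiag-bounds u≢v)

  x-triangle : ∀ u v w → x u w ≤ x u v + x v w
  x-triangle u v w with toSum (u ≟ v) | toSum (v ≟ w)
  ... | inj₁ refl | _         = ℚ.≤-reflexive (sym (trans (cong (_+ x u w) (x-diag u)) (ℚ.+-identityˡ (x u w))))
  ... | inj₂ _    | inj₁ refl = ℚ.≤-reflexive (sym (trans (cong (x u v +_) (x-diag v)) (ℚ.+-identityʳ (x u v))))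
  ... | inj₂ u≢v  | inj₂ v≢w  = begin
    x u w          ≤⟨ proj₂ (x-bounds u w) ⟩
    ½ + ½          ≤⟨ ℚ.+-mono-≤ (proj₁ (x-offdiag-bounds u≢v)) (proj₁ (x-offdiag-bounds v≢w)) ⟩
    x u v + x v w  ∎
    where open ℚ.≤-Reasoning

  x-feasible : LPFeasible n x
  x-feasible = record
    { sym   = λ u v → cong₂ (λ e q → (1ℚ - e) * (¾ + ¼ * q)) (⟦≟⟧-sym u v) (p-sym u v)
    ; diag  = x-diag
    ; lower = λ u v → proj₁ (x-bounds u v)
    ; upper = λ u v → proj₂ (x-bounds u v)
    ; tri   = x-triangle
    }

  sum²-px : ∑[ u < n ] ∑[ v < n ] (p u v * x u v) ≡ ¼ * (N * N) - N
  sum²-px = begin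
    ∑[ u < n ] ∑[ v < n ] (p u v * x u v)
      ≡⟨ sum-cong-≗ (λ u → sum-cong-≗ (λ v → px≡ u v ⟦ u ≟ v ⟧)) ⟩
    ∑[ u < n ] ∑[ v < n ] ((1ℚ - ⟦ u ≟ v ⟧) * (¼ + ¾ * p u v))
      ≡⟨ sum²-offdiagonal (λ u v → ¼ + ¾ * p u v) ⟩
    ∑[ u < n ] ∑[ v < n ] (¼ + ¾ * p u v) - ∑[ u < n ] (¼ + ¾ * p u u)
      ≡⟨ cong₂ _-_ (sum²-affine-p ¼ ¾) (trans (sum-cong-≗ (λ u → cong (λ q → ¼ + ¾ * q) (p-diag u))) (sum-const n 1ℚ)) ⟩
    N * (N * ¼) - N * 1ℚ
      ≡⟨ simplify N ⟩
    ¼ * (N * N) - N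
      ∎
    where
    open ≡-Reasoning
    px≡ : ∀ u v e → p u v * ((1ℚ - e) * (¾ + ¼ * p u v)) ≡ (1ℚ - e) * (¼ + ¾ * p u v)
    px≡ = p-cases (λ q → ∀ e → q * ((1ℚ - e) * (¾ + ¼ * q)) ≡ (1ℚ - e) * (¼ + ¾ * q))
                  (solve-∀ ℚ-ring) (solve-∀ ℚ-ring)
    simplify : ∀ N → N * (N * ¼) - N * 1ℚ ≡ ¼ * (N * N) - N
    simplify = solve-∀ ℚ-ring

  lpCost-x-value : lpCost I x ≡ ¼ * (N * N) - ⅓ * N - ⅙ * (¼ * (N * N) - N)
  lpCost-x-value = trans (lpCost-affine x-feasible) (cong₂ (λ s t → s - ⅙ * t) Λ-value sum²-px)

  -- a and b indicate "same side" and "opposite sides"; ω weights the ordered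
  -- pairs of distinct vertices on one side.
  a b ω : Fin n → Fin n → ℚ
  a u v = ½ + ½ * p u v
  b u v = ½ - ½ * p u v
  ω u w = (1ℚ - ⟦ u ≟ w ⟧) * a u w

  a-nonneg : ∀ u v → 0ℚ ≤ a u v
  a-nonneg = p-cases (λ q → 0ℚ ≤ ½ + ½ * q) (ℚ.≤ᵇ⇒≤ _) (ℚ.≤ᵇ⇒≤ _)

  b-nonneg : ∀ u v → 0ℚ ≤ b u v
  b-nonneg = p-cases (λ q → 0ℚ ≤ ½ - ½ * q) (ℚ.≤ᵇ⇒≤ _) (ℚ.≤ᵇ⇒≤ _)

  ω-nonneg : ∀ u w → 0ℚ ≤ ω u w
  ω-nonneg u w = *-nonneg (1-⟦⟧-nonneg (u ≟ w)) (a-nonneg u w)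

  ω-sym : ∀ u w → ω u w ≡ ω w u
  ω-sym u w = cong₂ (λ e q → (1ℚ - e) * (½ + ½ * q)) (⟦≟⟧-sym u w) (p-sym u w)

  b-row : ∀ u → ∑[ v < n ] b u v ≡ ½ * N
  b-row u = begin
    ∑[ v < n ] (½ - ½ * p u v)     ≡⟨ sum-cong-≗ (λ v → affine (p u v)) ⟩
    ∑[ v < n ] (½ + - ½ * p u v)   ≡⟨ sum-affine-p ½ (- ½) u ⟩
    N * ½                          ≡⟨ ℚ.*-comm N ½ ⟩
    ½ * N                          ∎
    where
    open ≡-Reasoning
    affine : ∀ q → ½ - ½ * q ≡ ½ + - ½ * q
    affine = solve-∀ ℚ-ring

  ω-row : ∀ u → ∑[ w < n ] ω u w ≡ ½ * N - 1ℚ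
  ω-row u = begin
    ∑[ w < n ] ω u w    ≡⟨ sum-offdiagonal u (a u) ⟩
    sum (a u) - a u u   ≡⟨ cong₂ _-_ (sum-affine-p ½ ½ u) (cong (λ q → ½ + ½ * q) (p-diag u)) ⟩
    N * ½ - 1ℚ          ≡⟨ cong (_- 1ℚ) (ℚ.*-comm N ½) ⟩
    ½ * N - 1ℚ          ∎
    where open ≡-Reasoning

  ω-opposite : ∀ {u w} → p u w ≡ - 1ℚ → ω u w ≡ 0ℚ
  ω-opposite {u} {w} p≡-1 = trans (cong (λ q → (1ℚ - ⟦ u ≟ w ⟧) * (½ + ½ * q)) p≡-1) (ℚ.*-zeroʳ (1ℚ - ⟦ u ≟ w ⟧))

  same-side-or-ω≡0 : ∀ u w → σ u ≡ σ w ⊎ ω u w ≡ 0ℚ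
  same-side-or-ω≡0 u w with σ-sign u | σ-sign w
  ... | inj₁ σu≡1  | inj₁ σw≡1  = inj₁ (trans σu≡1 (sym σw≡1))
  ... | inj₂ σu≡-1 | inj₂ σw≡-1 = inj₁ (trans σu≡-1 (sym σw≡-1))
  ... | inj₁ σu≡1  | inj₂ σw≡-1 = inj₂ (ω-opposite (cong₂ _*_ σu≡1 σw≡-1))
  ... | inj₂ σu≡-1 | inj₁ σw≡1  = inj₂ (ω-opposite (cong₂ _*_ σu≡-1 σw≡1))

  module FeasiblePoint {y : Fin n → Fin n → ℚ} (y-feasible : LPFeasible n y) where
    open LPFeasible y-feasible renaming (sym to y-sym; diag to y-diag; upper to y≤1)

    R : Fin n → ℚ
    R u = ∑[ v < n ] (b u v * y u v)

    W C : ℚ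
    W = ∑[ u < n ] ∑[ v < n ] (a u v * y u v)
    C = sum R

    same-side-triangle : ∀ {u w} → σ u ≡ σ w → ½ * N * y u w ≤ R u + R w
    same-side-triangle {u} {w} σu≡σw = begin
      ½ * N * y u w                                ≡⟨ cong (_* y u w) (b-row u) ⟨
      sum (b u) * y u w                            ≡⟨ sum-*ʳ (b u) (y u w) ⟨
      ∑[ v < n ] (b u v * y u w)                   ≤⟨ sum-mono-≤ (λ v → *-monoˡ-≤-nonneg (b u v) (b-nonneg u v) (tri u v w)) ⟩
      ∑[ v < n ] (b u v * (y u v + y v w))         ≡⟨ sum-cong-≗ (λ v → ℚ.*-distribˡ-+ (b u v) (y u v) (y v w)) ⟩
      ∑[ v < n ] (b u v * y u v + b u v * y v w)   ≡⟨ ∑-distrib-+ (λ v → b u v * y u v) (λ v → b u v * y v w) ⟩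
      R u + ∑[ v < n ] (b u v * y v w)             ≡⟨ cong (R u +_) (sum-cong-≗ (λ v → cong₂ _*_ (b-side v) (y-sym v w))) ⟩
      R u + R w                                    ∎
      where
      open ℚ.≤-Reasoning
      b-side : ∀ v → b u v ≡ b w v
      b-side v = cong (λ s → ½ - ½ * (s * σ v)) σu≡σw

    weighted-triangle : ∀ u w → ω u w * (½ * N * y u w) ≤ ω u w * (R u + R w)
    weighted-triangle u w with same-side-or-ω≡0 u w
    ... | inj₁ σu≡σw = *-monoˡ-≤-nonneg (ω u w) (ω-nonneg u w) (same-side-triangle σu≡σw)
    ... | inj₂ ω≡0   = subst (λ t → t * (½ * N * y u w) ≤ t * (R u + R w)) (sym ω≡0)
                         (ℚ.≤-reflexive (trans (ℚ.*-zeroˡ (½ * N * y u w)) (sym (ℚ.*-zeroˡ (R u + R w)))))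

    y-offdiagonal : ∀ u w → (1ℚ - ⟦ u ≟ w ⟧) * y u w ≡ y u w
    y-offdiagonal u w with toSum (u ≟ w)
    ... | inj₁ refl = trans (cong ((1ℚ - ⟦ u ≟ u ⟧) *_) (y-diag u)) (trans (ℚ.*-zeroʳ (1ℚ - ⟦ u ≟ u ⟧)) (sym (y-diag u)))
    ... | inj₂ u≢w  = trans (cong (λ e → (1ℚ - e) * y u w) (⟦⟧-no (u ≟ w) u≢w)) (ℚ.*-identityˡ (y u w))

    sum-weighted-y : ∑[ u < n ] ∑[ w < n ] (ω u w * (½ * N * y u w)) ≡ ½ * N * W
    sum-weighted-y = begin
      ∑[ u < n ] ∑[ w < n ] (ω u w * (½ * N * y u w))
        ≡⟨ sum-cong-≗ (λ u → sum-cong-≗ (λ w → trans (shuffle (½ * N) ⟦ u ≟ w ⟧ (a u w) (y u w))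
                                                      (cong (λ t → ½ * N * (a u w * t)) (y-offdiagonal u w)))) ⟩
      ∑[ u < n ] ∑[ w < n ] (½ * N * (a u w * y u w))
        ≡⟨ sum²-*ˡ (½ * N) (λ u w → a u w * y u w) ⟩
      ½ * N * W
        ∎
      where
      open ≡-Reasoning
      shuffle : ∀ h e s t → (1ℚ - e) * s * (h * t) ≡ h * (s * ((1ℚ - e) * t))
      shuffle = solve-∀ ℚ-ring

    sum-weighted-R : ∑[ u < n ] ∑[ w < n ] (ω u w * (R u + R w)) ≡ (½ * N - 1ℚ) * (C + C)
    sum-weighted-R = begin
      ∑[ u < n ] ∑[ w < n ] (ω u w * (R u + R w))
        ≡⟨ sum-cong-≗ (λ u → sum-cong-≗ (λ w → ℚ.*-distribˡ-+ (ω u w) (R u) (R w))) ⟩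
      ∑[ u < n ] ∑[ w < n ] (ω u w * R u + ω u w * R w)
        ≡⟨ sum²-+ (λ u w → ω u w * R u) (λ u w → ω u w * R w) ⟩
      ∑[ u < n ] ∑[ w < n ] (ω u w * R u) + ∑[ u < n ] ∑[ w < n ] (ω u w * R w)
        ≡⟨ cong (∑[ u < n ] ∑[ w < n ] (ω u w * R u) +_)
                (trans (∑-comm (λ u w → ω u w * R w)) (sum-cong-≗ (λ u → sum-cong-≗ (λ w → cong (_* R u) (ω-sym w u))))) ⟩
      ∑[ u < n ] ∑[ w < n ] (ω u w * R u) + ∑[ u < n ] ∑[ w < n ] (ω u w * R u)
        ≡⟨ cong (λ t → t + t) row-weights ⟩
      (½ * N - 1ℚ) * C + (½ * N - 1ℚ) * C
        ≡⟨ ℚ.*-distribˡ-+ (½ * N - 1ℚ) C C ⟨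
      (½ * N - 1ℚ) * (C + C)
        ∎
      where
      open ≡-Reasoning
      row-weights : ∑[ u < n ] ∑[ w < n ] (ω u w * R u) ≡ (½ * N - 1ℚ) * C
      row-weights = begin
        ∑[ u < n ] ∑[ w < n ] (ω u w * R u)   ≡⟨ sum-cong-≗ (λ u → trans (sum-*ʳ (ω u) (R u)) (cong (_* R u) (ω-row u))) ⟩
        ∑[ u < n ] ((½ * N - 1ℚ) * R u)       ≡⟨ sum-*ˡ (½ * N - 1ℚ) R ⟩
        (½ * N - 1ℚ) * C                      ∎

    averaged : ½ * N * W ≤ (½ * N - 1ℚ) * (C + C)
    averaged = begin
      ½ * N * W                                         ≡⟨ sum-weighted-y ⟨
      ∑[ u < n ] ∑[ w < n ] (ω u w * (½ * N * y u w))   ≤⟨ sum-mono-≤ (λ u → sum-mono-≤ (weighted-triangle u)) ⟩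
      ∑[ u < n ] ∑[ w < n ] (ω u w * (R u + R w))       ≡⟨ sum-weighted-R ⟩
      (½ * N - 1ℚ) * (C + C)                            ∎
      where open ℚ.≤-Reasoning

    y≤off-diagonal : ∀ u v → y u v ≤ 1ℚ - ⟦ u ≟ v ⟧
    y≤off-diagonal u v with toSum (u ≟ v)
    ... | inj₁ refl = ℚ.≤-reflexive
      (trans (y-diag u) (sym (trans (cong (λ e → 1ℚ - e) (⟦⟧-yes (u ≟ u) refl)) (ℚ.+-inverseʳ 1ℚ))))
    ... | inj₂ u≢v  = subst (y u v ≤_) (cong (λ e → 1ℚ - e) (sym (⟦⟧-no (u ≟ v) u≢v))) (y≤1 u v)

    W-bound : W ≤ ½ * N * N - N
    W-bound = begin
      W                                                  ≤⟨ sum-mono-≤ (λ u → sum-mono-≤ (ay≤ u)) ⟩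
      ∑[ u < n ] ∑[ v < n ] ((1ℚ - ⟦ u ≟ v ⟧) * a u v)   ≡⟨ sum²-offdiagonal a ⟩
      ∑[ u < n ] ∑[ v < n ] a u v - ∑[ u < n ] a u u     ≡⟨ cong₂ _-_ (sum²-affine-p ½ ½) diagonal ⟩
      N * (N * ½) - N * 1ℚ                               ≡⟨ simplify N ⟩
      ½ * N * N - N                                      ∎
      where
      open ℚ.≤-Reasoning
      diagonal : ∑[ u < n ] a u u ≡ N * 1ℚ
      diagonal = trans (sum-cong-≗ (λ u → cong (λ q → ½ + ½ * q) (p-diag u))) (sum-const n 1ℚ)
      simplify : ∀ N → N * (N * ½) - N * 1ℚ ≡ ½ * N * N - N
      simplify = solve-∀ ℚ-ring
      ay≤ : ∀ u v → a u v * y u v ≤ (1ℚ - ⟦ u ≟ v ⟧) * a u v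
      ay≤ u v = subst (a u v * y u v ≤_) (ℚ.*-comm (a u v) (1ℚ - ⟦ u ≟ v ⟧))
                  (*-monoˡ-≤-nonneg (a u v) (a-nonneg u v) (y≤off-diagonal u v))

    sum²-py : ∑[ u < n ] ∑[ v < n ] (p u v * y u v) ≡ W - C
    sum²-py = trans (sum-cong-≗ (λ u → sum-cong-≗ (λ v → sides (p u v) (y u v))))
                    (sum²-minus (λ u v → a u v * y u v) (λ u v → b u v * y u v))
      where
      sides : ∀ q t → q * t ≡ (½ + ½ * q) * t - (½ - ½ * q) * t
      sides = solve-∀ ℚ-ring

  sum²-py-bound : fromℕ 4 ≤ N → ∀ {y} → LPFeasible n y → ∑[ u < n ] ∑[ v < n ] (p u v * y u v) ≤ ¼ * (N * N) - N
  sum²-py-bound 4≤N y-feasible = subst (_≤ ¼ * (N * N) - N) (sym sum²-py) (dual-arithmetic 4≤N averaged W-bound)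
    where open FeasiblePoint y-feasible

  x-optimal : fromℕ 4 ≤ N → LPOptimal I x
  x-optimal 4≤N = x-feasible , λ y y-feasible → begin
    lpCost I x                                      ≡⟨ lpCost-affine x-feasible ⟩
    Λ - ⅙ * ∑[ u < n ] ∑[ v < n ] (p u v * x u v)   ≡⟨ cong (λ t → Λ - ⅙ * t) sum²-px ⟩
    Λ - ⅙ * (¼ * (N * N) - N)
      ≤⟨ ℚ.+-monoʳ-≤ Λ (ℚ.neg-antimono-≤ (*-monoˡ-≤-nonneg ⅙ (ℚ.≤ᵇ⇒≤ _) (sum²-py-bound 4≤N y-feasible))) ⟩
    Λ - ⅙ * ∑[ u < n ] ∑[ v < n ] (p u v * y u v)   ≡⟨ lpCost-affine y-feasible ⟨
    lpCost I y                                      ∎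
    where open ℚ.≤-Reasoning

halves : ∀ m → Fin (m ℕ.+ m) → ℚ
halves m = replicate m 1ℚ ++ replicate m (- 1ℚ)

halves-sign : ∀ m u → halves m u ≡ 1ℚ ⊎ halves m u ≡ - 1ℚ
halves-sign m u with splitAt m u
... | inj₁ _ = inj₁ refl
... | inj₂ _ = inj₂ refl

halves-balanced : ∀ m → sum (halves m) ≡ 0ℚ
halves-balanced m = begin
  sum (halves m)
    ≡⟨ sum-splitAt m (halves m) ⟩
  ∑[ i < m ] halves m (i ↑ˡ m) + ∑[ j < m ] halves m (m ↑ʳ j)
    ≡⟨ cong₂ _+_ (sum-cong-≗ (lookup-++ˡ (replicate m 1ℚ) (replicate m (- 1ℚ))))
                 (sum-cong-≗ (lookup-++ʳ (replicate m 1ℚ) (replicate m (- 1ℚ)))) ⟩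
  ∑[ i < m ] 1ℚ + ∑[ j < m ] (- 1ℚ)
    ≡⟨ cong₂ _+_ (sum-const m 1ℚ) (sum-const m (- 1ℚ)) ⟩
  fromℕ m * 1ℚ + fromℕ m * - 1ℚ
    ≡⟨ cancel (fromℕ m) ⟩
  0ℚ
    ∎
  where
  open ≡-Reasoning
  cancel : ∀ M → M * 1ℚ + M * - 1ℚ ≡ 0ℚ
  cancel = solve-∀ ℚ-ring

large-even-size : ∀ δ → 0ℚ < δ → ∃[ m ] (fromℕ 4 ≤ fromℕ (m ℕ.+ m) × 1ℚ ≤ δ * fromℕ (m ℕ.+ m))
large-even-size δ 0<δ = m , ≤-by-gap (K + K) (ℚ.+-mono-≤ 0≤K 0≤K) N≡4+2K , ≤-by-gap _ 0≤excess δN≡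
  where
  k m : ℕ
  k = proj₁ (archimedean δ (positive 0<δ))
  m = 2 ℕ.+ k
  K : ℚ
  K = fromℕ k
  0≤K : 0ℚ ≤ K
  0≤K = fromℕ-nonneg k
  1≤δK : 1ℚ ≤ δ * K
  1≤δK = proj₂ (archimedean δ (positive 0<δ))
  two-halves : ∀ K → 1ℚ + (1ℚ + K) + (1ℚ + (1ℚ + K)) ≡ fromℕ 4 + (K + K)
  two-halves = solve-∀ ℚ-ring
  N≡4+2K : fromℕ (m ℕ.+ m) ≡ fromℕ 4 + (K + K)
  N≡4+2K = trans (Mult.×-homo-+ 1ℚ m m) (two-halves K)
  expand : ∀ δ K → δ * (fromℕ 4 + (K + K)) ≡ 1ℚ + (fromℕ 4 * δ + (δ * K - 1ℚ) + δ * K)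
  expand = solve-∀ ℚ-ring
  δN≡ : δ * fromℕ (m ℕ.+ m) ≡ 1ℚ + (fromℕ 4 * δ + (δ * K - 1ℚ) + δ * K)
  δN≡ = trans (cong (δ *_) N≡4+2K) (expand δ K)
  0≤excess : 0ℚ ≤ fromℕ 4 * δ + (δ * K - 1ℚ) + δ * K
  0≤excess = ℚ.+-mono-≤ (ℚ.+-mono-≤ (*-nonneg {fromℕ 4} (ℚ.≤ᵇ⇒≤ _) (ℚ.<⇒≤ 0<δ)) (≤⇒0≤- 1≤δK))
                        (ℚ.≤-trans (ℚ.nonNegative⁻¹ 1ℚ) 1≤δK)

theorem6 : (δ : ℚ) → 0ℚ < δ →
    Σ ℕ λ n → Σ (Instance n) λ I → NegTriangle I ×
      Σ (Fin n → Fin n → ℚ) λ x → LPOptimal I x ×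
        (0ℚ < lpCost I x) ×
        (∀ (c : Clustering n) → (sixFifths - δ) * lpCost I x ≤ clusterCost I c)
theorem6 δ 0<δ = m ℕ.+ m , I , negTriangle , x , x-optimal 4≤N , lpCost-positive , gap
  where
  m : ℕ
  m = proj₁ (large-even-size δ 0<δ)
  4≤N : fromℕ 4 ≤ fromℕ (m ℕ.+ m)
  4≤N = proj₁ (proj₂ (large-even-size δ 0<δ))
  1≤δN : 1ℚ ≤ δ * fromℕ (m ℕ.+ m)
  1≤δN = proj₂ (proj₂ (large-even-size δ 0<δ))
  open BalancedInstance (halves m) (halves-sign m) (halves-balanced m)
  lpCost-positive : 0ℚ < lpCost I x
  lpCost-positive = subst (0ℚ <_) (sym lpCost-x-value) (lp-value-positive 4≤N)
  gap : ∀ c → (sixFifths - δ) * lpCost I x ≤ clusterCost I c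
  gap c = begin
    (sixFifths - δ) * lpCost I x                                      ≡⟨ cong ((sixFifths - δ) *_) lpCost-x-value ⟩
    (sixFifths - δ) * (¼ * (N * N) - ⅓ * N - ⅙ * (¼ * (N * N) - N))   ≤⟨ gap-arithmetic 4≤N (ℚ.<⇒≤ 0<δ) 1≤δN ⟩
    ¼ * (N * N) - ⅓ * N                                               ≡⟨ Λ-value ⟨
    Λ                                                                 ≤⟨ clusterCost≥Λ c ⟩
    clusterCost I c                                                   ∎
    where open ℚ.≤-Reasoning
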